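{- For every integer $x$, there is a set $S\subseteq\{0,1,\dots,17|x|\}$ with $|S+S|-|S-S|=x$.
   Context: For a finite set $S$ of integers, $S+S=\{s_1+s_2: s_1,s_2\in S\}$ and $S-S=\{s_1-s_2: s_1,s_2\in S\}$ (both empty if $S$ is empty). -}

module Defs where

open import Data.Nat using (ℕ)
open import Data.Integer using (ℤ; +_; _+_; _-_)
import Data.Integer.Properties as ℤP
open import Data.List using (List; length; deduplicate; cartesianProductWith; map)

-- A finite set of integers is represented by a list of its elements
-- (duplicates allowed; they do not affect the set or its cardinality).

card : List ℤ → ℕ
card xs = length (deduplicate ℤP._≟_ xs)

toℤ : List ℕ → List ℤ
toℤ = map (λ n → + n)

sumset : List ℤ → List ℤ
sumset S = cartesianProductWith _+_ S S

diffset : List ℤ → List ℤ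
diffset S = cartesianProductWith _-_ S S

{-# OPTIONS --safe #-}
-- For A ⊆ [0, d) let S = A + d·[0, k), i.e. blocks A d k. Then S + S = (A + A) + d·[0, 2k − 1), and
-- S − S is a translate of S + S′ for the reflection S′ = k d − 1 − S, which is blocks (mirror d A) d k.
-- A set C + d·[0, J + 1) with C ⊆ [0, 2d) meets its first block [0, d) in C ∩ [0, d), its last block
-- in (C ∩ [d, 2d)) shifted down by d, and each of the J blocks in between in the union of these two,
-- so |S + S| and |S − S| are both affine in J = 2k − 2. Four explicit sets A, for which the difference
-- has slope ±1 in J, realise every x ≠ 1 within the bound 17|x|; x = 1 needs a separate small set.
module Submission where

open import Defs
import Data.Integer.Properties as ℤP
open import Algebra.Properties.AbelianGroup ℤP.+-0-abelianGroup using (∙-cancelʳ)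
open import Data.Bool using (true; false; if_then_else_)
open import Data.Empty using (⊥-elim)
open import Data.Integer as ℤ using (ℤ; +_; -[1+_]; _-_; _⊖_; ∣_∣)
open import Data.List using (List; []; _∷_; length; filter; map; upTo; applyUpTo; cartesianProductWith)
open import Data.List.Membership.Propositional using (_∈_)
open import Data.List.Membership.Propositional.Properties
  using (∈-map⁺; ∈-map⁻; ∈-filter⁺; ∈-filter⁻; ∈-upTo⁺; ∈-upTo⁻;
         ∈-cartesianProductWith⁺; ∈-cartesianProductWith⁻; ∈-deduplicate⁺; ∈-deduplicate⁻)
open import Data.List.Membership.Propositional.Properties.WithK using (unique∧set⇒bag)
open import Data.List.Properties using (length-map)
open import Data.List.Relation.Binary.BagAndSetEquality using (∼bag⇒↭)
open import Data.List.Relation.Binary.Permutation.Propositional.Properties using (↭-length)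
open import Data.List.Relation.Unary.All using (All; []; all?)
import Data.List.Relation.Unary.All as All
import Data.List.Relation.Unary.All.Properties as All
open import Data.List.Relation.Unary.Unique.Propositional using (Unique)
import Data.List.Relation.Unary.Unique.Propositional.Properties as Unique
open import Data.List.Relation.Unary.Unique.DecPropositional.Properties ℤP._≟_ using (deduplicate-!)
open import Data.Nat using (ℕ; zero; suc; _+_; _*_; _∸_; _≤_; _<_; _≤?_; _<?_; z≤n; s≤s; z<s)
open import Data.Nat using () renaming (_*_ to _*ℕ_)
open import Data.Nat.DivMod using (_%_; m<n⇒m%n≡m; [m+kn]%n≡m%n)
open import Data.Nat.Properties
open import Data.List.Membership.DecPropositional _≟_ using (_∈?_)
open import Data.Nat.Tactic.RingSolver using (solve-∀; solve)
open import Data.Product using (∃; ∃₂; _×_; _,_; proj₁; proj₂)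
open import Data.Sum using (_⊎_; inj₁; inj₂; [_,_]) renaming (map to ⊎-map)
open import Function.Base using (_∘_; id)
open import Function.Bundles using (_⇔_; mk⇔; module Equivalence)
open import Function.Definitions using (Injective)
import Function.Properties.Equivalence as ⇔
open import Level using (Level)
open import Relation.Binary.PropositionalEquality
  using (_≡_; refl; sym; trans; cong; cong₂; subst; module ≡-Reasoning)
open import Relation.Nullary using (does; yes; no)
open import Relation.Nullary.Decidable using (from-yes)
open import Relation.Unary using (Pred; Decidable; _∪_)
open import Relation.Unary.Properties using (_∪?_)

open Equivalence using (to; from)
open ≡-Reasoning

private
  variable
    p q : Level
    P : Pred ℕ p
    Q : Pred ℕ q

countBelow : Decidable P → ℕ → ℕ
countBelow P? zero    = zero
countBelow P? (suc n) = (if does (P? 0) then suc else id) (countBelow (P? ∘ suc) n)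

countBelow-+ : (P? : Decidable P) (m n : ℕ) →
               countBelow P? (m + n) ≡ countBelow P? m + countBelow (λ r → P? (m + r)) n
countBelow-+ P? zero    n = refl
countBelow-+ P? (suc m) n with does (P? 0)
... | true  = cong suc (countBelow-+ (P? ∘ suc) m n)
... | false = countBelow-+ (P? ∘ suc) m n

countBelow-cong : (P? : Decidable P) (Q? : Decidable Q) {n : ℕ} →
                  (∀ {r} → r < n → P r ⇔ Q r) → countBelow P? n ≡ countBelow Q? n
countBelow-cong P? Q? {zero}  P⇔Q = refl
countBelow-cong P? Q? {suc n} P⇔Q with P? 0 | Q? 0
... | yes _  | yes _ = cong suc (countBelow-cong (P? ∘ suc) (Q? ∘ suc) (P⇔Q ∘ s≤s))
... | no _   | no _  = countBelow-cong (P? ∘ suc) (Q? ∘ suc) (P⇔Q ∘ s≤s)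
... | yes p  | no ¬q = ⊥-elim (¬q (to (P⇔Q z<s) p))
... | no ¬p  | yes q = ⊥-elim (¬p (from (P⇔Q z<s) q))

length-filter-applyUpTo : (P? : Decidable P) (f : ℕ → ℕ) (n : ℕ) →
                          length (filter P? (applyUpTo f n)) ≡ countBelow (P? ∘ f) n
length-filter-applyUpTo P? f zero    = refl
length-filter-applyUpTo P? f (suc n) with does (P? (f 0))
... | true  = cong suc (length-filter-applyUpTo P? (f ∘ suc) n)
... | false = length-filter-applyUpTo P? (f ∘ suc) n

card≡length : ∀ {xs ys : List ℤ} → Unique ys →
              (∀ {z} → z ∈ xs → z ∈ ys) → (∀ {z} → z ∈ ys → z ∈ xs) → card xs ≡ length ys
card≡length {xs} ys! xs⊆ys ys⊆xs = ↭-length (∼bag⇒↭ (unique∧set⇒bag (deduplicate-! xs) ys!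
  (mk⇔ (λ z∈ → xs⊆ys (∈-deduplicate⁻ ℤP._≟_ xs z∈)) (λ z∈ → ∈-deduplicate⁺ ℤP._≟_ (ys⊆xs z∈)))))

card-image : (P? : Decidable P) {N : ℕ} {f : ℕ → ℤ} {X : List ℤ} → Injective _≡_ _≡_ f →
             (∀ {n} → P n → n < N) → (∀ {n} → P n → f n ∈ X) →
             (∀ {z} → z ∈ X → ∃ λ n → P n × f n ≡ z) → card X ≡ countBelow P? N
card-image P? {N} {f} {X} f-inj P<N P⊆X X⊆fP = begin
  card X                              ≡⟨ card≡length ys! X⊆ys ys⊆X ⟩
  length (map f (filter P? (upTo N))) ≡⟨ length-map f (filter P? (upTo N)) ⟩
  length (filter P? (upTo N))         ≡⟨ length-filter-applyUpTo P? id N ⟩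
  countBelow P? N                     ∎
  where
  ys! : Unique (map f (filter P? (upTo N)))
  ys! = Unique.map⁺ f-inj (Unique.filter⁺ P? (Unique.upTo⁺ N))
  X⊆ys : ∀ {z} → z ∈ X → z ∈ map f (filter P? (upTo N))
  X⊆ys z∈X with n , Pn , refl ← X⊆fP z∈X = ∈-map⁺ f (∈-filter⁺ P? (∈-upTo⁺ (P<N Pn)) Pn)
  ys⊆X : ∀ {z} → z ∈ map f (filter P? (upTo N)) → z ∈ X
  ys⊆X z∈ys with n , n∈ , refl ← ∈-map⁻ f z∈ys = P⊆X (proj₂ (∈-filter⁻ P? {xs = upTo N} n∈))

[+m]-[+n]≡[+o]-[+p] : ∀ m n o p → m + p ≡ o + n → + m - + n ≡ + o - + p
[+m]-[+n]≡[+o]-[+p] m n o p m+p≡o+n = begin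
  + m - + n          ≡⟨ ℤP.[+m]-[+n]≡m⊖n m n ⟩
  m ⊖ n              ≡⟨ ℤP.+-cancelˡ-⊖ p m n ⟨
  (p + m) ⊖ (p + n)  ≡⟨ cong₂ _⊖_ (trans (+-comm p m) (trans m+p≡o+n (+-comm o n))) (+-comm p n) ⟩
  (n + o) ⊖ (n + p)  ≡⟨ ℤP.+-cancelˡ-⊖ n o p ⟩
  o ⊖ p              ≡⟨ ℤP.[+m]-[+n]≡m⊖n o p ⟨
  + o - + p          ∎

[+m]-[+n]≡+o : ∀ {m n o} → m ≡ o + n → + m - + n ≡ + o
[+m]-[+n]≡+o {m} {n} {o} m≡o+n =
  trans ([+m]-[+n]≡[+o]-[+p] m n o 0 (trans (+-identityʳ m) m≡o+n)) (ℤP.+-identityʳ (+ o))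

[+m]-[+n]≡-[1+k] : ∀ {m n k} → n ≡ suc k + m → + m - + n ≡ -[1+ k ]
[+m]-[+n]≡-[1+k] {m} {n} {k} n≡1+k+m = 
  [+m]-[+n]≡[+o]-[+p] m n 0 (suc k) (trans (+-comm m (suc k)) (sym n≡1+k+m))

divMod-unique : ∀ {d m n x y} → x < d → y < d → m * d + x ≡ n * d + y → m ≡ n × x ≡ y
divMod-unique {d@(suc _)} {m} {n} {x} {y} x<d y<d eq = m≡n , x≡y
  where
  x≡y : x ≡ y
  x≡y = begin
    x                ≡⟨ m<n⇒m%n≡m x<d ⟨
    x % d            ≡⟨ [m+kn]%n≡m%n x m d ⟨
    (x + m * d) % d  ≡⟨ cong (_% d) (trans (+-comm x (m * d)) (trans eq (+-comm (n * d) y))) ⟩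
    (y + n * d) % d  ≡⟨ [m+kn]%n≡m%n y n d ⟩
    y % d            ≡⟨ m<n⇒m%n≡m y<d ⟩
    y                ∎
  m≡n : m ≡ n
  m≡n = *-cancelʳ-≡ m n d (+-cancelʳ-≡ x (m * d) (n * d) (trans eq (cong (λ z → n * d + z) (sym x≡y))))

≤-+-split : ∀ {j t} → t ≤ j + j → ∃₂ λ i i′ → i ≤ j × i′ ≤ j × i + i′ ≡ t
≤-+-split {j} {t} t≤j+j with t ≤? j
... | yes t≤j = t , 0 , t≤j , z≤n , +-identityʳ t
... | no  t≰j with o , refl ← m≤n⇒∃[o]m+o≡n (≰⇒≥ t≰j) = j , o , ≤-refl , +-cancelˡ-≤ j o j t≤j+j , refl

≤-by-excess : ∀ {m n} o → m + o ≡ n → m ≤ n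
≤-by-excess {m} o refl = m≤m+n m o

_⊕_ : List ℕ → List ℕ → List ℕ
A ⊕ B = cartesianProductWith _+_ A B

⊕-< : ∀ {A B d n} → All (_< d) A → All (_< d) B → n ∈ A ⊕ B → n < d + d
⊕-< {A} {B} A<d B<d n∈ with a , b , a∈ , b∈ , refl ← ∈-cartesianProductWith⁻ _+_ A B n∈ =
  +-mono-< (All.lookup A<d a∈) (All.lookup B<d b∈)

blocks : List ℕ → ℕ → ℕ → List ℕ
blocks A d k = cartesianProductWith (λ a i → i * d + a) A (upTo k)

∈-blocks⁺ : ∀ {A d k a i} → a ∈ A → i < k → i * d + a ∈ blocks A d k
∈-blocks⁺ a∈A i<k = ∈-cartesianProductWith⁺ _ a∈A (∈-upTo⁺ i<k)

∈-blocks⁻ : ∀ {A d k n} → n ∈ blocks A d k → ∃₂ λ a i → a ∈ A × i < k × n ≡ i * d + a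
∈-blocks⁻ {A} {d} {k} n∈ with a , i , a∈A , i∈ , n≡ ← ∈-cartesianProductWith⁻ _ A (upTo k) n∈ =
  a , i , a∈A , ∈-upTo⁻ i∈ , n≡

blocks-< : ∀ {C d e J n} → All (_< e) C → n ∈ blocks C d (suc J) → n < e + J * d
blocks-< {C} {d} {e} {J} C<e n∈ with c , i , c∈C , i≤J , refl ← ∈-blocks⁻ {C} {d} n∈ =
  subst (_< e + J * d) (+-comm c (i * d)) (+-mono-<-≤ (All.lookup C<e c∈C) (*-monoˡ-≤ d (≤-pred i≤J)))

∈-⊕-blocks : ∀ {A B d j n} →
             n ∈ blocks A d (suc j) ⊕ blocks B d (suc j) ⇔ n ∈ blocks (A ⊕ B) d (suc (j + j))
∈-⊕-blocks {A} {B} {d} {j} = mk⇔ to′ from′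
  where
  S T U : List ℕ
  S = blocks A d (suc j)
  T = blocks B d (suc j)
  U = blocks (A ⊕ B) d (suc (j + j))
  interchange : ∀ i a i′ b → (i * d + a) + (i′ * d + b) ≡ (i + i′) * d + (a + b)
  interchange i a i′ b = solve (i ∷ a ∷ i′ ∷ b ∷ d ∷ [])
  to′ : ∀ {n} → n ∈ S ⊕ T → n ∈ U
  to′ n∈
    with s , s′ , s∈ , s′∈ , refl ← ∈-cartesianProductWith⁻ _+_ S T n∈
    with a , i , a∈ , i≤j , refl ← ∈-blocks⁻ {A} {d} s∈
    with b , i′ , b∈ , i′≤j , refl ← ∈-blocks⁻ {B} {d} s′∈ =
    subst (_∈ U) (sym (interchange i a i′ b))
          (∈-blocks⁺ (∈-cartesianProductWith⁺ _+_ a∈ b∈) (s≤s (+-mono-≤ (≤-pred i≤j) (≤-pred i′≤j))))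
  from′ : ∀ {n} → n ∈ U → n ∈ S ⊕ T
  from′ n∈
    with c , t , c∈ , t≤2j , refl ← ∈-blocks⁻ {A ⊕ B} {d} n∈
    with a , b , a∈ , b∈ , refl ← ∈-cartesianProductWith⁻ _+_ A B c∈
    with i , i′ , i≤j , i′≤j , refl ← ≤-+-split {j} (≤-pred t≤2j) =
    subst (_∈ S ⊕ T) (interchange i a i′ b)
          (∈-cartesianProductWith⁺ _+_ (∈-blocks⁺ {A} {d} a∈ (s≤s i≤j)) (∈-blocks⁺ {B} {d} b∈ (s≤s i′≤j)))

∈-blocks⇔ : ∀ {C d J t r} → All (_< d + d) C → r < d → t ≤ suc J →
            t * d + r ∈ blocks C d (suc J) ⇔ ((t ≤ J × r ∈ C) ⊎ (0 < t × d + r ∈ C))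
∈-blocks⇔ {C} {d} {J} {t} {r} C<2d r<d t≤1+J = mk⇔ (to′ r<d) from′
  where
  carry : ∀ i o → i * d + (d + o) ≡ suc i * d + o
  carry i o = solve (i ∷ o ∷ d ∷ [])
  to′ : ∀ {t r} → r < d → t * d + r ∈ blocks C d (suc J) → (t ≤ J × r ∈ C) ⊎ (0 < t × d + r ∈ C)
  to′ {t} r<d n∈ with c , i , c∈C , i≤J , eq ← ∈-blocks⁻ {C} {d} n∈ with c <? d
  ... | yes c<d with refl , refl ← divMod-unique {d} {t} {i} r<d c<d eq = inj₁ (≤-pred i≤J , c∈C)
  ... | no  c≮d with o , refl ← m≤n⇒∃[o]m+o≡n (≮⇒≥ c≮d)
                with refl , refl ← divMod-unique {d} {t} {suc i} r<d (+-cancelˡ-< d o d (All.lookup C<2d c∈C))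
                                                  (trans eq (carry i o)) = inj₂ (z<s , c∈C)
  from′ : (t ≤ J × r ∈ C) ⊎ (0 < t × d + r ∈ C) → t * d + r ∈ blocks C d (suc J)
  from′ (inj₁ (t≤J , r∈C))  = ∈-blocks⁺ {C} {d} r∈C (s≤s t≤J)
  from′ (inj₂ (0<t , d+r∈C)) with t′ , refl ← m≤n⇒∃[o]m+o≡n 0<t =
    subst (_∈ blocks C d (suc J)) (carry t′ r) (∈-blocks⁺ {C} {d} d+r∈C t≤1+J)

module _ {Lo Hi : Pred ℕ p} (Lo? : Decidable Lo) (Hi? : Decidable Hi) (d : ℕ) where

  private
    shift-block : (R : Pred ℕ q) (t : ℕ) {r : ℕ} {X : Set p} →
                  R (suc t * d + r) ⇔ X → R (d + (t * d + r)) ⇔ X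
    shift-block R t {r} {X} = subst (λ n → R n ⇔ X) (+-assoc d (t * d) r)

  countBelow-tail : ∀ J (Q? : Decidable Q) →
                    (∀ {t r} → r < d → t < J → Q (t * d + r) ⇔ (Lo ∪ Hi) r) →
                    (∀ {r} → r < d → Q (J * d + r) ⇔ Hi r) →
                    countBelow Q? (suc J * d) ≡ J * countBelow (Lo? ∪? Hi?) d + countBelow Hi? d
  countBelow-tail zero Q? _ last = begin
    countBelow Q? (d + 0) ≡⟨ cong (countBelow Q?) (+-identityʳ d) ⟩
    countBelow Q? d       ≡⟨ countBelow-cong Q? Hi? last ⟩
    countBelow Hi? d      ∎
  countBelow-tail {Q = Q} (suc J) Q? middle last = begin
    countBelow Q? (d + suc J * d)
      ≡⟨ countBelow-+ Q? d (suc J * d) ⟩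
    countBelow Q? d + countBelow (λ r → Q? (d + r)) (suc J * d)
      ≡⟨ cong₂ _+_ (countBelow-cong Q? (Lo? ∪? Hi?) (λ r<d → middle {0} r<d z<s))
                   (countBelow-tail J _ (λ {t} r<d t<J → shift-block Q t (middle r<d (s≤s t<J)))
                                       (shift-block Q J ∘ last)) ⟩
    countBelow (Lo? ∪? Hi?) d + (J * countBelow (Lo? ∪? Hi?) d + countBelow Hi? d)
      ≡⟨ +-assoc (countBelow (Lo? ∪? Hi?) d) _ _ ⟨
    suc J * countBelow (Lo? ∪? Hi?) d + countBelow Hi? d
      ∎

  countBelow-blocks : ∀ J (P? : Decidable P) →
                      (∀ {t r} → r < d → t ≤ suc J → P (t * d + r) ⇔ ((t ≤ J × Lo r) ⊎ (0 < t × Hi r))) →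
                      countBelow P? ((2 + J) * d) ≡
                      countBelow Lo? d + J * countBelow (Lo? ∪? Hi?) d + countBelow Hi? d
  countBelow-blocks {P = P} J P? blockwise = begin
    countBelow P? (d + suc J * d)
      ≡⟨ countBelow-+ P? d (suc J * d) ⟩
    countBelow P? d + countBelow (λ r → P? (d + r)) (suc J * d)
      ≡⟨ cong₂ _+_ (countBelow-cong P? Lo? first) (countBelow-tail J _ middle last) ⟩
    countBelow Lo? d + (J * countBelow (Lo? ∪? Hi?) d + countBelow Hi? d)
      ≡⟨ +-assoc (countBelow Lo? d) _ _ ⟨
    countBelow Lo? d + J * countBelow (Lo? ∪? Hi?) d + countBelow Hi? d
      ∎
    where
    first : ∀ {r} → r < d → P r ⇔ Lo r
    first r<d = ⇔.trans (blockwise {0} r<d z≤n) (mk⇔ [ proj₂ , (λ ()) ∘ proj₁ ] (λ lo → inj₁ (z≤n , lo)))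
    middle : ∀ {t r} → r < d → t < J → P (d + (t * d + r)) ⇔ (Lo ∪ Hi) r
    middle {t} r<d t<J = shift-block P t (⇔.trans (blockwise r<d (s≤s (<⇒≤ t<J)))
                                                (mk⇔ (⊎-map proj₂ proj₂) (⊎-map (t<J ,_) (z<s ,_))))
    last : ∀ {r} → r < d → P (d + (J * d + r)) ⇔ Hi r
    last r<d = shift-block P J (⇔.trans (blockwise r<d ≤-refl)
                                        (mk⇔ [ ⊥-elim ∘ <-irrefl refl ∘ proj₁ , proj₂ ] (λ hi → inj₂ (z<s , hi))))

blockCount : List ℕ → ℕ → ℕ → ℕ
blockCount C d J = countBelow low? d + J * countBelow (low? ∪? high?) d + countBelow high? d
  where
  low? : Decidable (_∈ C)
  low? r = r ∈? C
  high? : Decidable (λ r → d + r ∈ C)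
  high? r = d + r ∈? C

card-blocks : ∀ {C d J} {f : ℕ → ℤ} {X : List ℤ} → All (_< d + d) C → Injective _≡_ _≡_ f →
              (∀ {n} → n ∈ blocks C d (suc J) → f n ∈ X) →
              (∀ {z} → z ∈ X → ∃ λ n → n ∈ blocks C d (suc J) × f n ≡ z) →
              card X ≡ blockCount C d J
card-blocks {C} {d} {J} {X = X} C<2d f-inj into onto = begin
  card X                                          ≡⟨ card-image (_∈? blocks C d (suc J)) f-inj bound into onto ⟩
  countBelow (_∈? blocks C d (suc J)) ((2 + J) * d) ≡⟨ countBelow-blocks (_∈? C) (λ r → d + r ∈? C) d J _
                                                         (λ r<d t≤1+J → ∈-blocks⇔ C<2d r<d t≤1+J) ⟩
  blockCount C d J                                ∎
  where
  bound : ∀ {n} → n ∈ blocks C d (suc J) → n < (2 + J) * d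
  bound {n} n∈ = subst (n <_) (+-assoc d d (J * d)) (blocks-< {C} {d} C<2d n∈)

∈-sumset⁺ : ∀ {S n} → n ∈ S ⊕ S → + n ∈ sumset (toℤ S)
∈-sumset⁺ {S} n∈ with s , s′ , s∈ , s′∈ , refl ← ∈-cartesianProductWith⁻ _+_ S S n∈ =
  ∈-cartesianProductWith⁺ ℤ._+_ (∈-map⁺ +_ s∈) (∈-map⁺ +_ s′∈)

∈-sumset⁻ : ∀ {S z} → z ∈ sumset (toℤ S) → ∃ λ n → n ∈ S ⊕ S × + n ≡ z
∈-sumset⁻ {S} z∈
  with u , v , u∈ , v∈ , refl ← ∈-cartesianProductWith⁻ ℤ._+_ (toℤ S) (toℤ S) z∈
  with s , s∈ , refl ← ∈-map⁻ +_ u∈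
  with s′ , s′∈ , refl ← ∈-map⁻ +_ v∈ =
  s + s′ , ∈-cartesianProductWith⁺ _+_ s∈ s′∈ , refl

card-sumset-blocks : ∀ {A d} j → All (_< d) A →
                     card (sumset (toℤ (blocks A d (suc j)))) ≡ blockCount (A ⊕ A) d (j + j)
card-sumset-blocks {A} {d} j A<d =
  card-blocks {A ⊕ A} {d} (All.tabulate (⊕-< A<d A<d)) ℤP.+-injective
    (∈-sumset⁺ {S} ∘ from (∈-⊕-blocks {A} {A} {d} {j}))
    (λ z∈ → let n , n∈ , n≡z = ∈-sumset⁻ {S} z∈ in n , to (∈-⊕-blocks {A} {A} {d} {j}) n∈ , n≡z)
  where
  S : List ℕ
  S = blocks A d (suc j)

mirror : ℕ → List ℕ → List ℕ
mirror d = map (λ a → d ∸ suc a)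

mirror-< : ∀ {A d} → All (_< d) A → All (_< d) (mirror d A)
mirror-< A<d = All.map⁺ (All.map (∸-monoʳ-< z<s) A<d)

-- s″ = o d + b′ is the reflection k d − 1 − s′ of s′ = i d + b, so s − s′ = (s + s″) + 1 − k d.
mirror-identity : ∀ {d k b b′ i o} s → b′ + suc b ≡ d → suc (i + o) ≡ k →
                  suc (s + (o * d + b′)) + (i * d + b) ≡ s + k * d
mirror-identity {b = b} {b′} {i} {o} s refl refl = solve (s ∷ b ∷ b′ ∷ i ∷ o ∷ [])

mirror-shift : ∀ {d k b i o} s → b < d → suc (i + o) ≡ k →
               + suc (s + (o * d + (d ∸ suc b))) - + (k * d) ≡ + s - + (i * d + b)
mirror-shift {d} {k} {b} {i} {o} s b<d 1+i+o≡k =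
  [+m]-[+n]≡[+o]-[+p] _ (k * d) s (i * d + b) (mirror-identity {i = i} {o} s (m∸n+n≡m b<d) 1+i+o≡k)

module _ {A : List ℕ} {d k : ℕ} (A<d : All (_< d) A) where

  private
    S S′ : List ℕ
    S  = blocks A d k
    S′ = blocks (mirror d A) d k

  ∈-diffset⁺ : ∀ {n} → n ∈ S ⊕ S′ → + suc n - + (k * d) ∈ diffset (toℤ S)
  ∈-diffset⁺ n∈
    with s , s″ , s∈ , s″∈ , refl ← ∈-cartesianProductWith⁻ _+_ S S′ n∈
    with b′ , o , b′∈ , o<k , refl ← ∈-blocks⁻ {mirror d A} {d} s″∈
    with b , b∈ , refl ← ∈-map⁻ (λ a → d ∸ suc a) b′∈
    with i , 1+o+i≡k ← m≤n⇒∃[o]m+o≡n o<k =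
    subst (_∈ diffset (toℤ S))
          (sym (mirror-shift {d} {k} {b} {i} {o} s (All.lookup A<d b∈) 1+i+o≡k))
          (∈-cartesianProductWith⁺ ℤ._-_ (∈-map⁺ +_ s∈) (∈-map⁺ +_ (∈-blocks⁺ {A} {d} b∈ i<k)))
    where
    1+i+o≡k : suc (i + o) ≡ k
    1+i+o≡k = trans (cong suc (+-comm i o)) 1+o+i≡k
    i<k : i < k
    i<k = ≤-trans (s≤s (m≤n+m i o)) (≤-reflexive 1+o+i≡k)

  ∈-diffset⁻ : ∀ {z} → z ∈ diffset (toℤ S) → ∃ λ n → n ∈ S ⊕ S′ × + suc n - + (k * d) ≡ z
  ∈-diffset⁻ z∈
    with u , v , u∈ , v∈ , refl ← ∈-cartesianProductWith⁻ ℤ._-_ (toℤ S) (toℤ S) z∈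
    with s , s∈ , refl ← ∈-map⁻ +_ u∈
    with s′ , s′∈ , refl ← ∈-map⁻ +_ v∈
    with b , i , b∈ , i<k , refl ← ∈-blocks⁻ {A} {d} s′∈
    with o , 1+i+o≡k ← m≤n⇒∃[o]m+o≡n i<k =
    s + (o * d + (d ∸ suc b)) ,
    ∈-cartesianProductWith⁺ _+_ s∈ (∈-blocks⁺ {mirror d A} {d} (∈-map⁺ (λ a → d ∸ suc a) b∈) o<k) ,
    mirror-shift {d} {k} {b} {i} {o} s (All.lookup A<d b∈) 1+i+o≡k
    where
    o<k : o < k
    o<k = ≤-trans (s≤s (m≤n+m o i)) (≤-reflexive 1+i+o≡k)

card-diffset-blocks : ∀ {A d} j → All (_< d) A →
                      card (diffset (toℤ (blocks A d (suc j)))) ≡ blockCount (A ⊕ mirror d A) d (j + j)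
card-diffset-blocks {A} {d} j A<d =
  card-blocks {A ⊕ mirror d A} {d} (All.tabulate (⊕-< A<d (mirror-< A<d))) shift-injective
    (∈-diffset⁺ A<d ∘ from (∈-⊕-blocks {A} {mirror d A} {d} {j}))
    (λ z∈ → let n , n∈ , n≡z = ∈-diffset⁻ A<d z∈ in n , to (∈-⊕-blocks {A} {mirror d A} {d} {j}) n∈ , n≡z)
  where
  shift-injective : Injective _≡_ _≡_ (λ n → + suc n - + (suc j * d))
  shift-injective eq = suc-injective (ℤP.+-injective (∙-cancelʳ (ℤ.- + (suc j * d)) _ _ eq))

Realisable : ℤ → Set
Realisable x = ∃ λ (S : List ℕ) → All (λ s → s ≤ 17 *ℕ ∣ x ∣) S ×
                                  (+ card (sumset (toℤ S)) - + card (diffset (toℤ S)) ≡ x)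

realise : ∀ A d j {x} → All (_< d) A → suc j * d ≤ 17 *ℕ ∣ x ∣ →
          + blockCount (A ⊕ A) d (j + j) - + blockCount (A ⊕ mirror d A) d (j + j) ≡ x → Realisable x
realise A d j A<d size excess =
  blocks A d (suc j) ,
  All.tabulate (λ s∈ → ≤-trans (<⇒≤ (blocks-< {A} {d} A<d s∈)) size) ,
  trans (cong₂ (λ u v → + u - + v) (card-sumset-blocks j A<d) (card-diffset-blocks j A<d)) excess

-- |S + S| − |S − S| for S = blocks A d (j + 1) and J = 2j is J for A₀, J − 3 for A₁,
-- −J − 1 for A₂ and −J − 2 for A₃.
A₀ A₁ A₂ A₃ : List ℕ
A₀ = 0 ∷ 1 ∷ 3 ∷ 4 ∷ 5 ∷ 8 ∷ []
A₁ = 0 ∷ 1 ∷ 4 ∷ 8 ∷ 9 ∷ 11 ∷ []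
A₂ = 0 ∷ 1 ∷ 3 ∷ []
A₃ = 0 ∷ 1 ∷ 2 ∷ 6 ∷ []

realisable-pos-even : ∀ m → Realisable (+ (suc m + suc m))
realisable-pos-even m =
  realise A₀ 12 (suc m) (from-yes (all? (_<? 12) A₀)) (≤-by-excess (10 + 22 * m) size)
    ([+m]-[+n]≡+o (excess (suc m + suc m)))
  where
  size : (2 + m) * 12 + (10 + 22 * m) ≡ 17 * (suc m + suc m)
  size = solve (m ∷ [])
  excess : ∀ J → 12 + J * 12 + 3 ≡ J + (8 + J * 11 + 7)
  excess = solve-∀

realisable-pos-odd : ∀ m → Realisable (+ suc (suc m + suc m))
realisable-pos-odd m =
  realise A₁ 12 (3 + m) (from-yes (all? (_<? 12) A₁)) (≤-by-excess (3 + 22 * m) size)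
    ([+m]-[+n]≡+o excess)
  where
  size : (4 + m) * 12 + (3 + 22 * m) ≡ 17 * suc (suc m + suc m)
  size = solve (m ∷ [])
  excess : 9 + ((3 + m) + (3 + m)) * 12 + 9 ≡
           suc (suc m + suc m) + (11 + ((3 + m) + (3 + m)) * 11 + 10)
  excess = solve (m ∷ [])

realisable-neg-odd : ∀ m → Realisable -[1+ m + m ]
realisable-neg-odd m =
  realise A₂ 6 m (from-yes (all? (_<? 6) A₂)) (≤-by-excess (11 + 28 * m) size)
    ([+m]-[+n]≡-[1+k] (excess (m + m)))
  where
  size : (1 + m) * 6 + (11 + 28 * m) ≡ 17 * suc (m + m)
  size = solve (m ∷ [])
  excess : ∀ J → 4 + J * 6 + 3 ≡ suc J + (5 + J * 5 + 1)
  excess = solve-∀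

realisable-neg-even : ∀ m → Realisable -[1+ suc (m + m) ]
realisable-neg-even m =
  realise A₃ 8 m (from-yes (all? (_<? 8) A₃)) (≤-by-excess (26 + 26 * m) size)
    ([+m]-[+n]≡-[1+k] (excess (m + m)))
  where
  size : (1 + m) * 8 + (26 + 26 * m) ≡ 17 * suc (suc (m + m))
  size = solve (m ∷ [])
  excess : ∀ J → 6 + J * 8 + 5 ≡ suc (suc J) + (7 + J * 7 + 2)
  excess = solve-∀

data Half : ℕ → Set where
  even : ∀ m → Half (m + m)
  odd  : ∀ m → Half (suc (m + m))

half : ∀ n → Half n
half zero    = even 0
half (suc n) with half n
... | even m = odd m
... | odd m  = subst Half (cong suc (+-suc m m)) (even (suc m))

S₁ : List ℕ
S₁ = 0 ∷ 2 ∷ 3 ∷ 4 ∷ 7 ∷ 11 ∷ 12 ∷ 14 ∷ []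

theorem4 : ∀ (x : ℤ) → ∃ λ (S : List ℕ) →
             All (λ s → s ≤ 17 *ℕ ∣ x ∣) S ×
             (+ card (sumset (toℤ S)) - + card (diffset (toℤ S)) ≡ x)
theorem4 (+ n) with half n
... | even zero    = [] , [] , refl
... | even (suc m) = realisable-pos-even m
... | odd zero     = S₁ , from-yes (all? (_≤? 17) S₁) , refl
... | odd (suc m)  = realisable-pos-odd m
theorem4 -[1+ n ] with half n
... | even m = realisable-neg-odd m
... | odd m  = realisable-neg-even m
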